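{- For every infinite sequence $A$ of positive integers there exists an infinite sequence $B$ of positive integers such that $FS(A\times B)$ contains no infinite arithmetic progression $\{p+nd: n\geq 0\}$ ($p,d\in\mathbb{Z}^2$, $d\neq 0$) that is not parallel to either coordinate axis (i.e. with both coordinates of $d$ nonzero).
   Context: $FS(Z)$ denotes the set of all finite sums of distinct elements of $Z\subseteq\mathbb{N}^2$, where $\mathbb{N}=\{1,2,\dots\}$. -}

module Defs where

open import Data.Nat using (ℕ; suc; _<_; _≤_)
open import Data.Integer as ℤ using (ℤ; +_)
open import Data.List using (List; []; map)
open import Data.Nat.ListAction using (sum)
open import Data.List.Relation.Unary.Unique.Propositional using (Unique)
open import Data.Product using (_×_; _,_; proj₁; proj₂; ∃)
open import Function using (_∘_)
open import Relation.Binary.PropositionalEquality using (_≡_; _≢_)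

-- An infinite set of positive integers, given by its strictly increasing
-- enumeration a 0 < a 1 < a 2 < ... with all values ≥ 1.
InfPosSeq : (ℕ → ℕ) → Set
InfPosSeq a = (∀ i → 1 ≤ a i) × (∀ i → a i < a (suc i))

-- (x , y) ∈ FS(A × B), where A = {a i}, B = {b j}:
-- (x , y) is the sum of a nonempty finite family of distinct elements
-- (a i , b j) of A × B, encoded by a duplicate-free nonempty list of
-- index pairs (i , j) (distinct index pairs ↔ distinct elements, since
-- a and b are injective).
InFS : (ℕ → ℕ) → (ℕ → ℕ) → ℤ × ℤ → Set
InFS a b (x , y) =
  ∃ λ (S : List (ℕ × ℕ)) →
    (S ≢ []) × Unique S
    × (+ sum (map (a ∘ proj₁) S) ≡ x)
    × (+ sum (map (b ∘ proj₂) S) ≡ y)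

ContainsAP : (ℕ → ℕ) → (ℕ → ℕ) → ℤ × ℤ → ℤ × ℤ → Set
ContainsAP a b (p₁ , p₂) (d₁ , d₂) =
  ∀ (n : ℕ) → InFS a b (p₁ ℤ.+ (+ n) ℤ.* d₁ , p₂ ℤ.+ (+ n) ℤ.* d₂)

-- Take b 0 = 1 and b (k + 1) = 8 (k + 1)² (b k)².  Suppose FS(A × B) contained
-- the progression (P₁ + n D₁ , P₂ + n D₂); as its terms are nonnegative, the
-- steps D₁ , D₂ are positive.  Let C exceed all four parameters, J = C + 1, and
-- pick a term whose second coordinate Y lies in [b J − C , b J).  Its
-- representing set S only uses b-indices j < J, so |S| ≥ Y / b C, while the
-- first coordinate X is O(C Y).  The numbers i J + j for (i , j) ∈ S are
-- distinct and at most J a i, so at most m of them are below m and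
-- |S| ≤ m + J X / m for every m.  Taking m = 2 b C J C, these bounds are
-- incompatible because b J = 8 (b C)² J².
module Submission where

open import Defs
open import Data.Nat using (ℕ)
open import Data.Integer using (ℤ; 0ℤ)
open import Data.Product using (_×_; _,_; Σ; proj₁; proj₂)
open import Relation.Binary.PropositionalEquality using (_≢_)
open import Relation.Nullary using (¬_)

open import Data.Nat
open import Data.Nat.Properties
open import Data.Nat.DivMod using (_/_; _%_; m≡m%n+[m/n]*n; m%n<n; m/n*n≤m)
open import Data.Nat.ListAction using (sum)
open import Data.Nat.Tactic.RingSolver using (solve-∀)
import Data.Integer as ℤ
import Data.Integer.Properties as ℤ
open import Data.List using (List; []; _∷_; map; length; filter)
open import Data.List.Properties using (length-map; filter-all; filter-accept; filter-reject)
open import Data.List.Relation.Unary.All as All using (All; []; _∷_)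
open import Data.List.Relation.Unary.All.Properties using (all-filter)
open import Data.List.Relation.Unary.AllPairs using ([]; _∷_)
open import Data.List.Relation.Unary.Unique.Propositional using (Unique)
import Data.List.Relation.Unary.Unique.Propositional.Properties as Unique
open import Data.Product using (∃; ∃₂)
open import Data.Empty using (⊥; ⊥-elim)
open import Function using (_∘_)
open import Relation.Binary.Definitions using (tri<; tri≈; tri>)
open import Relation.Binary.PropositionalEquality using (_≡_; refl; sym; trans; cong; subst)
open import Relation.Nullary using (yes; no; contradiction)

length≤1+length-filter-< : ∀ m {xs} → Unique xs → All (_< suc m) xs →
                            length xs ≤ suc (length (filter (_<? m) xs))
length≤1+length-filter-< m {[]} _ _ = z≤n
length≤1+length-filter-< m {x ∷ xs} (x∉xs ∷ xs-unique) (x<1+m ∷ xs<1+m) with x <? m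
... | yes x<m rewrite filter-accept (_<? m) {xs = xs} x<m =
  s≤s (length≤1+length-filter-< m xs-unique xs<1+m)
... | no x≮m rewrite filter-reject (_<? m) {xs = xs} x≮m =
  s≤s (≤-reflexive (cong length (sym (filter-all (_<? m) xs<m))))
  where
  x≡m : x ≡ m
  x≡m = ≤-antisym (≤-pred x<1+m) (≮⇒≥ x≮m)
  xs<m : All (_< m) xs
  xs<m = All.zipWith (λ (x≢y , y<1+m) → ≤∧≢⇒< (≤-pred y<1+m) (λ y≡m → x≢y (trans x≡m (sym y≡m))))
                     (x∉xs , xs<1+m)

unique-bounded⇒length≤ : ∀ m {xs} → Unique xs → All (_< m) xs → length xs ≤ m
unique-bounded⇒length≤ zero {[]} _ _ = z≤n
unique-bounded⇒length≤ zero {x ∷ xs} _ (() ∷ _)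
unique-bounded⇒length≤ (suc m) {xs} xs-unique xs<1+m = begin
  length xs                           ≤⟨ length≤1+length-filter-< m xs-unique xs<1+m ⟩
  suc (length (filter (_<? m) xs))    ≤⟨ s≤s (unique-bounded⇒length≤ m
                                            (Unique.filter⁺ (_<? m) xs-unique)
                                            (all-filter (_<? m) xs)) ⟩
  suc m                               ∎
  where open ≤-Reasoning

*-length≤sum+*-length-filter-< : ∀ m xs → m * length xs ≤ sum xs + m * length (filter (_<? m) xs)
*-length≤sum+*-length-filter-< m [] = ≤-refl
*-length≤sum+*-length-filter-< m (x ∷ xs) with x <? m
... | yes x<m rewrite filter-accept (_<? m) {xs = xs} x<m = begin
  m * suc (length xs)              ≡⟨ *-suc m _ ⟩
  m + m * length xs                ≤⟨ +-monoʳ-≤ m (*-length≤sum+*-length-filter-< m xs) ⟩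
  m + (sum xs + m * L)             ≤⟨ m≤n+m _ x ⟩
  x + (m + (sum xs + m * L))       ≡⟨ reassociate x m (sum xs) L ⟩
  x + sum xs + m * suc L           ∎
  where
  open ≤-Reasoning
  L : ℕ
  L = length (filter (_<? m) xs)
  reassociate : ∀ x m s l → x + (m + (s + m * l)) ≡ x + s + m * suc l
  reassociate = solve-∀
... | no x≮m rewrite filter-reject (_<? m) {xs = xs} x≮m = begin
  m * suc (length xs)              ≡⟨ *-suc m _ ⟩
  m + m * length xs                ≤⟨ +-mono-≤ (≮⇒≥ x≮m) (*-length≤sum+*-length-filter-< m xs) ⟩
  x + (sum xs + m * L)             ≡⟨ +-assoc x (sum xs) (m * L) ⟨
  x + sum xs + m * L               ∎
  where
  open ≤-Reasoning
  L : ℕ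
  L = length (filter (_<? m) xs)

unique⇒*-length≤sum+square : ∀ m {xs} → Unique xs → m * length xs ≤ sum xs + m * m
unique⇒*-length≤sum+square m {xs} xs-unique =
  ≤-trans (*-length≤sum+*-length-filter-< m xs)
          (+-monoʳ-≤ (sum xs) (*-monoʳ-≤ m
            (unique-bounded⇒length≤ m (Unique.filter⁺ (_<? m) xs-unique) (all-filter (_<? m) xs))))

unique-map⁺ : ∀ {A : Set} (f : A → ℕ) {P : A → Set} →
              (∀ {x y} → P x → P y → f x ≡ f y → x ≡ y) →
              ∀ {xs} → All P xs → Unique xs → Unique (map f xs)
unique-map⁺ f f-inj {[]} _ _ = []
unique-map⁺ f {P} f-inj {x ∷ xs} (px ∷ pxs) (x∉xs ∷ xs-unique) =
  fx∉fxs pxs x∉xs ∷ unique-map⁺ f f-inj pxs xs-unique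
  where
  fx∉fxs : ∀ {ys} → All P ys → All (x ≢_) ys → All (f x ≢_) (map f ys)
  fx∉fxs [] [] = []
  fx∉fxs (py ∷ pys) (x≢y ∷ x∉ys) = (x≢y ∘ f-inj px py) ∷ fx∉fxs pys x∉ys

module _ {A : Set} where

  sum-map-≤-* : ∀ (f g : A → ℕ) k {xs} → All (λ x → f x ≤ k * g x) xs →
                sum (map f xs) ≤ k * sum (map g xs)
  sum-map-≤-* f g k [] = ≤-reflexive (sym (*-zeroʳ k))
  sum-map-≤-* f g k {x ∷ xs} (fx≤ ∷ fxs≤) =
    ≤-trans (+-mono-≤ fx≤ (sum-map-≤-* f g k fxs≤)) (≤-reflexive (sym (*-distribˡ-+ k (g x) _)))

  sum-map-≤-length* : ∀ (f : A → ℕ) c {xs} → All (λ x → f x ≤ c) xs →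
                      sum (map f xs) ≤ length xs * c
  sum-map-≤-length* f c [] = z≤n
  sum-map-≤-length* f c (fx≤c ∷ fxs≤c) = +-mono-≤ fx≤c (sum-map-≤-length* f c fxs≤c)

  ≤-sum-map : ∀ (f : A → ℕ) xs → All (λ x → f x ≤ sum (map f xs)) xs
  ≤-sum-map f [] = []
  ≤-sum-map f (x ∷ xs) =
    m≤m+n (f x) _ ∷ All.map (λ fy≤ → ≤-trans fy≤ (m≤n+m _ (f x))) (≤-sum-map f xs)

module StrictlyIncreasing {s : ℕ → ℕ} (s-< : ∀ k → s k < s (suc k)) where

  mono-≤′ : ∀ {i j} → i ≤′ j → s i ≤ s j
  mono-≤′ (≤′-reflexive refl) = ≤-refl
  mono-≤′ (≤′-step i≤′j) = ≤-trans (mono-≤′ i≤′j) (<⇒≤ (s-< _))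

  mono-≤ : ∀ {i j} → i ≤ j → s i ≤ s j
  mono-≤ = mono-≤′ ∘ ≤⇒≤′

  cancel-< : ∀ {i j} → s i < s j → i < j
  cancel-< {i} {j} si<sj with i <? j
  ... | yes i<j = i<j
  ... | no i≮j = contradiction (mono-≤ (≮⇒≥ i≮j)) (<⇒≱ si<sj)

  sum-map<⇒All< : ∀ {A : Set} (f : A → ℕ) {xs} J → sum (map (s ∘ f) xs) < s J →
                  All (λ x → f x < J) xs
  sum-map<⇒All< f {xs} J sum<sJ =
    All.map (λ sfx≤sum → cancel-< (≤-<-trans sfx≤sum sum<sJ)) (≤-sum-map (s ∘ f) xs)

InfPosSeq⇒suc≤ : ∀ {a} → InfPosSeq a → ∀ i → suc i ≤ a i
InfPosSeq⇒suc≤ (a-pos , a-<) zero = a-pos 0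
InfPosSeq⇒suc≤ (a-pos , a-<) (suc i) = <-≤-trans (s≤s (InfPosSeq⇒suc≤ (a-pos , a-<) i)) (a-< i)

lacunary : ℕ → ℕ
lacunary zero = 1
lacunary (suc k) = lacunary k * lacunary k * (8 * suc k * suc k)

lacunary-pos : ∀ k → 1 ≤ lacunary k
lacunary-pos zero = s≤s z≤n
lacunary-pos (suc k) = *-mono-≤ (*-mono-≤ (lacunary-pos k) (lacunary-pos k)) (s≤s z≤n)

lacunary-< : ∀ k → lacunary k < lacunary (suc k)
lacunary-< k = begin-strict
  b                                <⟨ m<m+n b (lacunary-pos k) ⟩
  b + b                            ≡⟨ double b ⟩
  b * 1 * 2                        ≤⟨ *-mono-≤ (*-monoʳ-≤ b (lacunary-pos k)) 2≤8[1+k]² ⟩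
  b * b * (8 * suc k * suc k)      ∎
  where
  open ≤-Reasoning
  b : ℕ
  b = lacunary k
  double : ∀ x → x + x ≡ x * 1 * 2
  double = solve-∀
  2≤8[1+k]² : 2 ≤ 8 * suc k * suc k
  2≤8[1+k]² = ≤-trans (s≤s (s≤s z≤n)) (≤-trans (m≤m*n 8 (suc k)) (m≤m*n (8 * suc k) (suc k)))

lacunary-infPosSeq : InfPosSeq lacunary
lacunary-infPosSeq = lacunary-pos , lacunary-<

encode : ℕ → ℕ × ℕ → ℕ
encode J (i , j) = i * J + j

encode-< : ∀ J i {j} → j < J → encode J (i , j) < suc i * J
encode-< J i j<J = ≤-trans (+-monoʳ-< (i * J) j<J) (≤-reflexive (+-comm (i * J) J))

encode-<-encode : ∀ J {i i′ j} j′ → j < J → i < i′ → encode J (i , j) < encode J (i′ , j′)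
encode-<-encode J {i} {i′} j′ j<J i<i′ =
  ≤-trans (encode-< J i j<J) (≤-trans (*-monoˡ-≤ J i<i′) (m≤m+n (i′ * J) j′))

encode-injective : ∀ J {x y} → proj₂ x < J → proj₂ y < J → encode J x ≡ encode J y → x ≡ y
encode-injective J {i , j} {i′ , j′} j<J j′<J eq with <-cmp i i′
... | tri< i<i′ _ _ = contradiction eq (<⇒≢ (encode-<-encode J j′ j<J i<i′))
... | tri> _ _ i′<i = contradiction (sym eq) (<⇒≢ (encode-<-encode J j j′<J i′<i))
... | tri≈ _ refl _ = cong (i ,_) (+-cancelˡ-≡ (i * J) j j′ eq)

-- The codes i J + j of the pairs are distinct and at most J a i.
length-bound : ∀ {a} → InfPosSeq a → ∀ J {S : List (ℕ × ℕ)} → Unique S →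
               All (λ x → proj₂ x < J) S →
               ∀ m → m * length S ≤ J * sum (map (a ∘ proj₁) S) + m * m
length-bound {a} a-inf J {S} S-unique S<J m = begin
  m * length S                       ≡⟨ cong (m *_) (length-map (encode J) S) ⟨
  m * length (map (encode J) S)      ≤⟨ unique⇒*-length≤sum+square m
                                          (unique-map⁺ (encode J) (encode-injective J) S<J S-unique) ⟩
  sum (map (encode J) S) + m * m     ≤⟨ +-monoˡ-≤ (m * m)
                                          (sum-map-≤-* (encode J) (a ∘ proj₁) J (All.map encode≤ S<J)) ⟩
  J * sum (map (a ∘ proj₁) S) + m * m ∎
  where
  open ≤-Reasoning
  encode≤ : ∀ {x} → proj₂ x < J → encode J x ≤ J * a (proj₁ x)
  encode≤ {i , j} j<J = ≤-trans (<⇒≤ (encode-< J i j<J))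
                          (≤-trans (*-monoˡ-≤ J (InfPosSeq⇒suc≤ a-inf i)) (≤-reflexive (*-comm (a i) J)))

ℕ-valued-AP⇒positive-step : ∀ (X : ℕ → ℕ) p d → (∀ n → ℤ.+ X n ≡ p ℤ.+ ℤ.+ n ℤ.* d) → d ≢ 0ℤ →
            ∃₂ λ P D → ∀ n → X n ≡ P + n * suc D
ℕ-valued-AP⇒positive-step X ℤ.-[1+ _ ] d X≡ d≢0 with X≡ 0
... | ()
ℕ-valued-AP⇒positive-step X (ℤ.+ P) (ℤ.+ zero) X≡ d≢0 = ⊥-elim (d≢0 refl)
ℕ-valued-AP⇒positive-step X (ℤ.+ P) (ℤ.+ suc D) X≡ d≢0 =
  P , D , λ n → ℤ.+-injective (trans (X≡ n) (cong (ℤ._+_ (ℤ.+ P)) (sym (ℤ.pos-* n (suc D)))))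
-- A negative step makes the term at n = P + 1 negative.
ℕ-valued-AP⇒positive-step X (ℤ.+ P) ℤ.-[1+ k ] X≡ d≢0 = ⊥-elim (negative (X≡ (suc P)))
  where
  P≤P[1+k]+k : P ≤ k + P * suc k
  P≤P[1+k]+k = ≤-trans (m≤m*n P (suc k)) (m≤n+m _ k)
  negative : ℤ.+ X (suc P) ≢ P ℤ.⊖ suc (k + P * suc k)
  negative eq
    with trans eq (trans (ℤ.⊖-< (s≤s P≤P[1+k]+k)) (cong (λ t → ℤ.- ℤ.+ t) (+-∸-assoc 1 P≤P[1+k]+k)))
  ... | ()

term-in-window : ∀ P D T → P < T → ∃ λ n → P + n * suc D < T × T ≤ P + n * suc D + suc D
term-in-window P D T P<T = q , below , above
  where
  open ≤-Reasoning
  d k q : ℕ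
  d = suc D
  k = T ∸ suc P
  q = k / d
  T≡ : suc P + k ≡ T
  T≡ = m+[n∸m]≡n P<T
  shuffle : ∀ P r q d → suc P + (r + q * d) ≡ P + q * d + suc r
  shuffle = solve-∀
  below : P + q * d < T
  below = begin-strict
    P + q * d    ≤⟨ +-monoʳ-≤ P (m/n*n≤m k d) ⟩
    P + k        <⟨ n<1+n _ ⟩
    suc P + k    ≡⟨ T≡ ⟩
    T            ∎
  above : T ≤ P + q * d + d
  above = begin
    T                             ≡⟨ T≡ ⟨
    suc P + k                     ≡⟨ cong (suc P +_) (m≡m%n+[m/n]*n k d) ⟩
    suc P + (k % d + q * d)       ≡⟨ shuffle P (k % d) q d ⟩
    P + q * d + suc (k % d)       ≤⟨ +-monoʳ-≤ (P + q * d) (m%n<n k d) ⟩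
    P + q * d + d                 ∎

-- Eliminating n between the coordinates: D₂ X + D₁ P₂ = D₂ P₁ + D₁ Y.
AP-coordinate-bound : ∀ {C P₁ P₂ D₁ X Y} D₂ .{{_ : NonZero D₂}} n →
                      X ≡ P₁ + n * D₁ → Y ≡ P₂ + n * D₂ → P₁ ≤ C → D₁ ≤ C → D₂ ≤ C →
                      X ≤ C * C + C * Y
AP-coordinate-bound {C} {P₁} {P₂} {D₁} D₂ n refl refl P₁≤C D₁≤C D₂≤C = begin
  X                               ≤⟨ m≤n*m X D₂ ⟩
  D₂ * X                          ≤⟨ m≤m+n _ _ ⟩
  D₂ * X + D₁ * P₂                ≡⟨ eliminate P₁ P₂ n D₁ D₂ ⟩
  D₂ * P₁ + D₁ * Y                ≤⟨ +-mono-≤ (*-mono-≤ D₂≤C P₁≤C) (*-monoˡ-≤ Y D₁≤C) ⟩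
  C * C + C * Y                   ∎
  where
  open ≤-Reasoning
  X Y : ℕ
  X = P₁ + n * D₁
  Y = P₂ + n * D₂
  eliminate : ∀ P₁ P₂ n D₁ D₂ → D₂ * (P₁ + n * D₁) + D₁ * P₂ ≡ D₂ * P₁ + D₁ * (P₂ + n * D₂)
  eliminate = solve-∀

-- Choosing m = 2 β J C turns the bounds into T < 3 C + 4 β² J C, which is at most T.
bounds-incompatible : ∀ β C N X Y → .{{NonZero β}} → .{{NonZero C}} →
                      let J = suc C ; T = β * β * (8 * J * J) in
                      (∀ m → m * N ≤ J * X + m * m) → Y ≤ N * β → X ≤ C * C + C * Y →
                      T ≤ Y + C → Y < T → ⊥
bounds-incompatible β C N X Y count Y≤Nβ X≤C²+CY T≤Y+C Y<T = <⇒≱ T<W W≤T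
  where
  open ≤-Reasoning
  J T u W Q : ℕ
  J = suc C
  T = β * β * (8 * J * J)
  u = β * J * C
  W = 3 * C + 4 * (β * u)
  Q = β * β * J * J
  u≢0 : NonZero u
  u≢0 = m*n≢0 (β * J) C {{m*n≢0 β J}}
  β²≢0 : NonZero (β * β)
  β²≢0 = m*n≢0 β β

  expand : ∀ u N β C → u * (2 * (N * β + C)) ≡ β * ((u + u) * N) + (u + u) * C
  expand = solve-∀
  collect : ∀ β J C Y →
            β * (J * (C * C + C * Y) + (β * J * C + β * J * C) * (β * J * C + β * J * C))
              + (β * J * C + β * J * C) * C
            ≡ β * J * C * (Y + (3 * C + 4 * (β * (β * J * C))))
  collect = solve-∀
  βu≡ : ∀ β J C → β * (β * J * C) ≡ β * β * J * C
  βu≡ = solve-∀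
  T≡ : ∀ β J → 4 * (β * β * J * J) + 4 * (β * β * J * J) ≡ β * β * (8 * J * J)
  T≡ = solve-∀

  u[2T]≤u[Y+W] : u * (2 * T) ≤ u * (Y + W)
  u[2T]≤u[Y+W] = begin
    u * (2 * T)
      ≤⟨ *-monoʳ-≤ u (*-monoʳ-≤ 2 (≤-trans T≤Y+C (+-monoˡ-≤ C Y≤Nβ))) ⟩
    u * (2 * (N * β + C))
      ≡⟨ expand u N β C ⟩
    β * ((u + u) * N) + (u + u) * C
      ≤⟨ +-monoˡ-≤ ((u + u) * C) (*-monoʳ-≤ β (count (u + u))) ⟩
    β * (J * X + (u + u) * (u + u)) + (u + u) * C
      ≤⟨ +-monoˡ-≤ ((u + u) * C) (*-monoʳ-≤ β (+-monoˡ-≤ ((u + u) * (u + u)) (*-monoʳ-≤ J X≤C²+CY))) ⟩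
    β * (J * (C * C + C * Y) + (u + u) * (u + u)) + (u + u) * C
      ≡⟨ collect β J C Y ⟩
    u * (Y + W) ∎

  T<W : T < W
  T<W = +-cancelˡ-< T T W (begin-strict
    T + T    ≡⟨ cong (T +_) (+-identityʳ T) ⟨
    2 * T    ≤⟨ *-cancelˡ-≤ u {{u≢0}} u[2T]≤u[Y+W] ⟩
    Y + W    <⟨ +-monoˡ-< W Y<T ⟩
    T + W    ∎)

  C≤Q : C ≤ Q
  C≤Q = ≤-trans (n≤1+n C) (≤-trans (m≤n*m J (β * β) {{β²≢0}}) (m≤m*n (β * β * J) J))

  W≤T : W ≤ T
  W≤T = begin
    3 * C + 4 * (β * u)   ≤⟨ +-monoˡ-≤ (4 * (β * u)) (*-monoˡ-≤ C {3} {4} (n≤1+n 3)) ⟩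
    4 * C + 4 * (β * u)   ≤⟨ +-mono-≤ (*-monoʳ-≤ 4 C≤Q)
                               (*-monoʳ-≤ 4 (≤-trans (≤-reflexive (βu≡ β J C))
                                                     (*-monoʳ-≤ (β * β * J) (n≤1+n C)))) ⟩
    4 * Q + 4 * Q         ≡⟨ T≡ β J ⟩
    T                     ∎

RepresentsAP : (ℕ → ℕ) → (ℕ → ℕ) → ℕ → ℕ → ℕ → ℕ → Set
RepresentsAP a b P₁ D₁ P₂ D₂ =
  ∀ n → ∃ λ (S : List (ℕ × ℕ)) → Unique S
        × sum (map (a ∘ proj₁) S) ≡ P₁ + n * suc D₁
        × sum (map (b ∘ proj₂) S) ≡ P₂ + n * suc D₂

ContainsAP⇒RepresentsAP : ∀ {a b} p d → proj₁ d ≢ 0ℤ → proj₂ d ≢ 0ℤ → ContainsAP a b p d →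
                          ∃₂ λ P₁ D₁ → ∃₂ λ P₂ D₂ → RepresentsAP a b P₁ D₁ P₂ D₂
ContainsAP⇒RepresentsAP {a} {b} (p₁ , p₂) (d₁ , d₂) d₁≢0 d₂≢0 contains
  with ℕ-valued-AP⇒positive-step (λ n → sum (map (a ∘ proj₁) (proj₁ (contains n)))) p₁ d₁
                 (λ n → proj₁ (proj₂ (proj₂ (proj₂ (contains n))))) d₁≢0
     | ℕ-valued-AP⇒positive-step (λ n → sum (map (b ∘ proj₂) (proj₁ (contains n)))) p₂ d₂
                 (λ n → proj₂ (proj₂ (proj₂ (proj₂ (contains n))))) d₂≢0
... | P₁ , D₁ , X≡ | P₂ , D₂ , Y≡ =
  P₁ , D₁ , P₂ , D₂ , λ n → proj₁ (contains n) , proj₁ (proj₂ (proj₂ (contains n))) , X≡ n , Y≡ n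

no-representation-near-lacunary-term :
  ∀ {a} → InfPosSeq a → ∀ C .{{_ : NonZero C}} {S : List (ℕ × ℕ)} → Unique S →
  let X = sum (map (a ∘ proj₁) S) ; Y = sum (map (lacunary ∘ proj₂) S) in
  Y < lacunary (suc C) → lacunary (suc C) ≤ Y + C → X ≤ C * C + C * Y → ⊥
no-representation-near-lacunary-term {a} a-inf C {S} S-unique Y<T T≤Y+C X≤ =
  bounds-incompatible (lacunary C) C (length S) X Y {{>-nonZero (lacunary-pos C)}}
    (length-bound a-inf (suc C) S-unique S<J) Y≤ X≤ T≤Y+C Y<T
  where
  open StrictlyIncreasing lacunary-<
  X Y : ℕ
  X = sum (map (a ∘ proj₁) S)
  Y = sum (map (lacunary ∘ proj₂) S)
  S<J : All (λ x → proj₂ x < suc C) S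
  S<J = sum-map<⇒All< proj₂ (suc C) Y<T
  Y≤ : Y ≤ length S * lacunary C
  Y≤ = sum-map-≤-length* (lacunary ∘ proj₂) (lacunary C) (All.map (mono-≤ ∘ ≤-pred) S<J)

lacunary-avoids-AP : ∀ {a} → InfPosSeq a → ∀ P₁ D₁ P₂ D₂ → ¬ RepresentsAP a lacunary P₁ D₁ P₂ D₂
lacunary-avoids-AP {a} a-inf P₁ D₁ P₂ D₂ represents =
  no-representation-near-lacunary-term a-inf C S-unique Y<T T≤Y+C X≤
  where
  open ≤-Reasoning
  total C : ℕ
  total = P₁ + P₂ + D₁ + D₂
  C = suc total
  P₁≤total : P₁ ≤ total
  P₁≤total = ≤-trans (m≤m+n P₁ P₂) (≤-trans (m≤m+n _ D₁) (m≤m+n _ D₂))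
  P₂≤total : P₂ ≤ total
  P₂≤total = ≤-trans (m≤n+m P₂ P₁) (≤-trans (m≤m+n _ D₁) (m≤m+n _ D₂))
  D₁≤total : D₁ ≤ total
  D₁≤total = ≤-trans (m≤n+m D₁ (P₁ + P₂)) (m≤m+n _ D₂)
  D₂≤total : D₂ ≤ total
  D₂≤total = m≤n+m D₂ (P₁ + P₂ + D₁)
  T : ℕ
  T = lacunary (suc C)
  P₂<T : P₂ < T
  P₂<T = ≤-trans (s≤s (m≤n⇒m≤1+n (m≤n⇒m≤1+n P₂≤total))) (InfPosSeq⇒suc≤ lacunary-infPosSeq (suc C))
  window : ∃ λ n → P₂ + n * suc D₂ < T × T ≤ P₂ + n * suc D₂ + suc D₂
  window = term-in-window P₂ D₂ T P₂<T
  n : ℕ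
  n = proj₁ window
  S : List (ℕ × ℕ)
  S = proj₁ (represents n)
  S-unique : Unique S
  S-unique = proj₁ (proj₂ (represents n))
  X≡ : sum (map (a ∘ proj₁) S) ≡ P₁ + n * suc D₁
  X≡ = proj₁ (proj₂ (proj₂ (represents n)))
  Y : ℕ
  Y = sum (map (lacunary ∘ proj₂) S)
  Y≡ : Y ≡ P₂ + n * suc D₂
  Y≡ = proj₂ (proj₂ (proj₂ (represents n)))
  Y<T : Y < T
  Y<T = subst (_< T) (sym Y≡) (proj₁ (proj₂ window))
  T≤Y+C : T ≤ Y + C
  T≤Y+C = begin
    T                             ≤⟨ proj₂ (proj₂ window) ⟩
    P₂ + n * suc D₂ + suc D₂      ≤⟨ +-monoʳ-≤ (P₂ + n * suc D₂) (s≤s D₂≤total) ⟩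
    P₂ + n * suc D₂ + C           ≡⟨ cong (_+ C) Y≡ ⟨
    Y + C                         ∎
  X≤ : sum (map (a ∘ proj₁) S) ≤ C * C + C * Y
  X≤ = AP-coordinate-bound (suc D₂) n X≡ Y≡ (m≤n⇒m≤1+n P₁≤total) (s≤s D₁≤total) (s≤s D₂≤total)

proposition4p3 : (a : ℕ → ℕ) → InfPosSeq a →
    Σ (ℕ → ℕ) λ b → InfPosSeq b ×
    ((p d : ℤ × ℤ) → proj₁ d ≢ 0ℤ → proj₂ d ≢ 0ℤ →
    ¬ ContainsAP a b p d)
proposition4p3 a a-inf =
  lacunary , lacunary-infPosSeq , λ p d d₁≢0 d₂≢0 contains →
    let P₁ , D₁ , P₂ , D₂ , represents = ContainsAP⇒RepresentsAP p d d₁≢0 d₂≢0 contains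
    in lacunary-avoids-AP a-inf P₁ D₁ P₂ D₂ represents
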